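{- For every positive integer $r$, $\sigma\big(\mathrm{Cay}(\mathbb{Z}_3^r,\{(1,0,\dots,0),(0,1,0,\dots,0),\dots,(0,\dots,0,1)\})\big)=1$.
   Context: For an abelian group $\Gamma$ and $C\subseteq\Gamma$, $\mathrm{Cay}(\Gamma,C)$ is the simple undirected graph on $\Gamma$ with $\{x,y\}$ an edge iff $y-x\in C$ or $x-y\in C$ (so here $x\sim y$ iff they differ in exactly one coordinate). For a graph $G$, $\alpha(G)$ is its independence number and $\sigma(G)$ is the minimum of the maximum degree of $G[K]$ over all vertex sets $K$ with $|K|>\alpha(G)$. -}

module Defs where

open import Data.Nat using (ℕ; zero; suc; _+_; _∸_; _⊔_; _<_; _≤_)
open import Data.Nat.DivMod using (_mod_)
open import Data.Fin using (Fin; toℕ) renaming (zero to fz; suc to fs)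
open import Data.Fin.Properties using () renaming (_≟_ to _≟F_)
open import Data.Vec using (Vec; zipWith; replicate; tabulate)
open import Data.Vec.Properties using (≡-dec)
open import Data.List using (List; map; length; foldr; filter; allFin)
open import Data.List.Membership.Propositional using (_∈_)
open import Data.List.Membership.DecPropositional using () renaming (_∈?_ to ∈?-gen)
open import Data.List.Relation.Unary.Unique.Propositional using (Unique)
open import Data.Product using (Σ; _×_; _,_)
open import Data.Sum using (_⊎_)
open import Relation.Nullary using (¬_; Dec)
open import Relation.Nullary.Decidable using (_⊎-dec_; does)
open import Data.Bool using (if_then_else_)
open import Relation.Binary.PropositionalEquality using (_≡_)

Z3 : Set
Z3 = Fin 3

_+₃_ : Z3 → Z3 → Z3
a +₃ b = (toℕ a + toℕ b) mod 3

-₃_ : Z3 → Z3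
-₃ a = (3 ∸ toℕ a) mod 3

Z3^ : ℕ → Set
Z3^ r = Vec Z3 r

_⊕_ : ∀ {r} → Z3^ r → Z3^ r → Z3^ r
x ⊕ y = zipWith _+₃_ x y

_⊖_ : ∀ {r} → Z3^ r → Z3^ r → Z3^ r
x ⊖ y = zipWith (λ a b → a +₃ (-₃ b)) x y

_≟V_ : ∀ {r} → (x y : Z3^ r) → Dec (x ≡ y)
_≟V_ = ≡-dec _≟F_

e : ∀ {r} → Fin r → Z3^ r
e j = tabulate (λ i → if does (i ≟F j) then fs fz else fz)

basis : (r : ℕ) → List (Z3^ r)
basis r = map e (allFin r)

CayAdj : ∀ {r} → List (Z3^ r) → Z3^ r → Z3^ r → Set
CayAdj C x y = ((y ⊖ x) ∈ C) ⊎ ((x ⊖ y) ∈ C)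

cayAdj? : ∀ {r} (C : List (Z3^ r)) (x y : Z3^ r) → Dec (CayAdj C x y)
cayAdj? C x y = ∈?-gen _≟V_ (y ⊖ x) C ⊎-dec ∈?-gen _≟V_ (x ⊖ y) C

-- Finite vertex sets are represented by duplicate-free lists.
-- K is independent in the graph given by Adj.
Independent : ∀ {r} → List (Z3^ r) → List (Z3^ r) → Set
Independent C K = ∀ {x y} → x ∈ K → y ∈ K → ¬ CayAdj C x y

IsAlpha : ∀ {r} → List (Z3^ r) → ℕ → Set
IsAlpha {r} C a =
  (Σ (List (Z3^ r)) λ K → Unique K × Independent C K × length K ≡ a)
  × (∀ (K : List (Z3^ r)) → Unique K → Independent C K → length K ≤ a)

degIn : ∀ {r} → List (Z3^ r) → List (Z3^ r) → Z3^ r → ℕ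
degIn C K v = length (filter (cayAdj? C v) K)

maxDegIn : ∀ {r} → List (Z3^ r) → List (Z3^ r) → ℕ
maxDegIn C K = foldr _⊔_ 0 (map (degIn C K) K)

-- σ(G) = s, given α(G) = a: s is the minimum of Δ(G[K]) over all
-- vertex sets K with |K| > a.
IsSigma : ∀ {r} → List (Z3^ r) → ℕ → ℕ → Set
IsSigma {r} C a s =
  (Σ (List (Z3^ r)) λ K → Unique K × a < length K × maxDegIn C K ≡ s)
  × (∀ (K : List (Z3^ r)) → Unique K → a < length K → s ≤ maxDegIn C K)

-- Adjacent vertices of Cay(ℤ₃^(r+1), C) have different coordinate sums, so every level set
-- {x : Σ x = c} is independent; it has 3^r elements. Any 3^r + 1 vertices contain two with the
-- same last r coordinates, and two distinct elements of ℤ₃ differ by ±1, so these two are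
-- adjacent. Hence α = 3^r and every larger set induces an edge. A set of 3^r + 1 vertices
-- inducing a matching is built recursively: put 0 in front of the previous one and add 1v and
-- 2v for every v with Σ v = 2. No element of the previous set has coordinate sum 2, so 1v and
-- 2v are adjacent only to each other.
module Submission where

open import Defs
open import Data.Nat using (ℕ; zero; suc; _+_; _*_; _^_; _≤_; _<_; _⊔_; z≤n; s≤s; _≤?_)
open import Data.Nat.Properties
  using (≤-trans; ≤-reflexive; ≤-antisym; m≤m⊔n; m≤n⊔m; ⊔-lub; +-suc; ≰⇒>; <⇒≱; module ≤-Reasoning)
open import Data.Product using (Σ; ∃; ∃₂; _×_; _,_)
open import Data.Sum using (_⊎_; inj₁; inj₂; [_,_]′) renaming (map to ⊎-map)
open import Data.Empty using (⊥-elim)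
open import Data.Unit using (tt)
open import Relation.Nullary using (¬_; yes; no)
open import Relation.Nullary.Decidable using (toWitness; _→-dec_; _⊎-dec_; ¬?)
open import Relation.Unary using (Pred; Decidable)
open import Relation.Binary.Definitions using (DecidableEquality)
open import Relation.Binary.PropositionalEquality
open import Function using (_∘_)
open import Data.Fin using (Fin) renaming (zero to fz; suc to fs)
open import Data.Fin.Properties using (all?; _≟_)
open import Data.Vec using (Vec; _∷_; []; tabulate; tail)
open import Data.Vec.Properties using (∷-injective; ∷-injectiveˡ; ∷-injectiveʳ)
open import Data.List using (List; _∷_; []; map; _++_; length; filter; foldr; allFin; cartesianProductWith)
open import Data.List.Properties using (length-++; length-map; foldr-preservesᵇ; foldr-preservesᵒ; filter-some)
open import Data.List.Membership.Propositional using (_∈_; lose)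
open import Data.List.Membership.Propositional.Properties
  using (∈-map⁺; ∈-map⁻; ∈-++⁺ˡ; ∈-++⁺ʳ; ∈-++⁻; ∈-∃++; ∈-allFin; ∈-filter⁻;
         ∈-cartesianProductWith⁺; ∈-cartesianProductWith⁻)
import Data.List.Membership.DecPropositional as DecMembership
open import Data.List.Relation.Binary.Subset.Propositional using (_⊆_)
open import Data.List.Relation.Unary.Any as Any using (here; there)
open import Data.List.Relation.Unary.All as All using (All)
import Data.List.Relation.Unary.All.Properties as Allₚ
open import Data.List.Relation.Unary.AllPairs using (_∷_; [])
open import Data.List.Relation.Unary.Unique.Propositional using (Unique)
open import Data.List.Relation.Unary.Unique.Propositional.Properties
  using (++⁺; map⁺; cartesianProductWith⁺; filter⁺; allFin⁺; Unique[x∷xs]⇒x∉xs)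

module _ {A : Set} where

  length-≤-⊆ : {xs ys : List A} → Unique xs → xs ⊆ ys → length xs ≤ length ys
  length-≤-⊆ {[]} _ _ = z≤n
  length-≤-⊆ {x ∷ xs} x∷xs!@(_ ∷ xs!) xs⊆ys with ∈-∃++ (xs⊆ys (here refl))
  ... | ys₁ , ys₂ , refl = begin
      suc (length xs)               ≤⟨ s≤s (length-≤-⊆ xs! xs⊆ys₁++ys₂) ⟩
      suc (length (ys₁ ++ ys₂))     ≡⟨ cong suc (length-++ ys₁) ⟩
      suc (length ys₁ + length ys₂) ≡⟨ +-suc (length ys₁) (length ys₂) ⟨
      length ys₁ + length (x ∷ ys₂) ≡⟨ length-++ ys₁ ⟨
      length (ys₁ ++ x ∷ ys₂)       ∎
    where
    open ≤-Reasoning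
    xs⊆ys₁++ys₂ : xs ⊆ ys₁ ++ ys₂
    xs⊆ys₁++ys₂ w∈xs with ∈-++⁻ ys₁ (xs⊆ys (there w∈xs))
    ... | inj₁ w∈ys₁ = ∈-++⁺ˡ w∈ys₁
    ... | inj₂ (here refl) = ⊥-elim (Unique[x∷xs]⇒x∉xs x∷xs! w∈xs)
    ... | inj₂ (there w∈ys₂) = ∈-++⁺ʳ ys₁ w∈ys₂

  length-filter≤1 : ∀ {p} {P : Pred A p} (P? : Decidable P) {xs : List A} {u : A} →
                    Unique xs → (∀ {w} → w ∈ xs → P w → w ≡ u) → length (filter P? xs) ≤ 1
  length-filter≤1 P? xs! only-u =
    length-≤-⊆ {ys = _ ∷ []} (filter⁺ P? xs!)
      (λ w∈ → let w∈xs , Pw = ∈-filter⁻ P? w∈ in here (only-u w∈xs Pw))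

module _ {A B : Set} (_≟B_ : DecidableEquality B) (f : A → B) where

  Collision : List A → Set
  Collision xs = ∃₂ λ x y → x ∈ xs × y ∈ xs × x ≢ y × f x ≡ f y

  unique-map⊎collision : {xs : List A} → Unique xs → Unique (map f xs) ⊎ Collision xs
  unique-map⊎collision {[]} [] = inj₁ []
  unique-map⊎collision {x ∷ xs} (x∉xs ∷ xs!) with unique-map⊎collision xs!
  ... | inj₂ (y , z , y∈ , z∈ , y≢z , fy≡fz) = inj₂ (y , z , there y∈ , there z∈ , y≢z , fy≡fz)
  ... | inj₁ fxs! with DecMembership._∈?_ _≟B_ (f x) (map f xs)
  ...   | no fx∉ = inj₁ (Allₚ.¬Any⇒All¬ (map f xs) fx∉ ∷ fxs!)
  ...   | yes fx∈ = let y , y∈ , fx≡fy = ∈-map⁻ f fx∈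
                    in inj₂ (x , y , here refl , there y∈ , All.lookup x∉xs y∈ , fx≡fy)

  pigeonhole : {xs : List A} {ys : List B} →
               Unique xs → (∀ x → f x ∈ ys) → length ys < length xs → Collision xs
  pigeonhole {xs} {ys} xs! f∈ys ys<xs with unique-map⊎collision xs!
  ... | inj₂ collision = collision
  ... | inj₁ fxs! = ⊥-elim (<⇒≱ ys<xs (begin
      length xs         ≡⟨ length-map f xs ⟨
      length (map f xs) ≤⟨ length-≤-⊆ fxs! map-f⊆ys ⟩
      length ys         ∎))
    where
    open ≤-Reasoning
    map-f⊆ys : map f xs ⊆ ys
    map-f⊆ys fx∈ with ∈-map⁻ f fx∈
    ... | x , _ , refl = f∈ys x

module _ {k : ℕ} where

  foldr-⊔-lub : {ns : List ℕ} → All (_≤ k) ns → foldr _⊔_ 0 ns ≤ k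
  foldr-⊔-lub = foldr-preservesᵇ ⊔-lub z≤n

  ∈⇒≤foldr-⊔ : {ns : List ℕ} → k ∈ ns → k ≤ foldr _⊔_ 0 ns
  ∈⇒≤foldr-⊔ {ns} k∈ns = foldr-preservesᵒ ≤-⊔ 0 ns (inj₂ (Any.map ≤-reflexive k∈ns))
    where
    ≤-⊔ : ∀ m n → k ≤ m ⊎ k ≤ n → k ≤ m ⊔ n
    ≤-⊔ m n = [ (λ k≤m → ≤-trans k≤m (m≤m⊔n m n)) , (λ k≤n → ≤-trans k≤n (m≤n⊔m m n)) ]′

vectorsOver : {A : Set} → List A → (n : ℕ) → List (Vec A n)
vectorsOver xs zero = [] ∷ []
vectorsOver xs (suc n) = cartesianProductWith _∷_ xs (vectorsOver xs n)

module _ {A B C : Set} (f : A → B → C) where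

  length-cartesianProductWith : (xs : List A) (ys : List B) →
                                length (cartesianProductWith f xs ys) ≡ length xs * length ys
  length-cartesianProductWith [] ys = refl
  length-cartesianProductWith (x ∷ xs) ys = begin
    length (map (f x) ys ++ cartesianProductWith f xs ys)    ≡⟨ length-++ (map (f x) ys) ⟩
    length (map (f x) ys) + length (cartesianProductWith f xs ys)
      ≡⟨ cong₂ _+_ (length-map (f x) ys) (length-cartesianProductWith xs ys) ⟩
    length ys + length xs * length ys                        ∎
    where open ≡-Reasoning

module _ {A : Set} {xs : List A} where

  ∈-vectorsOver : (∀ x → x ∈ xs) → ∀ {n} (v : Vec A n) → v ∈ vectorsOver xs n
  ∈-vectorsOver ∈xs [] = here refl
  ∈-vectorsOver ∈xs (x ∷ v) = ∈-cartesianProductWith⁺ _∷_ (∈xs x) (∈-vectorsOver ∈xs v)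

  vectorsOver-unique : Unique xs → ∀ n → Unique (vectorsOver xs n)
  vectorsOver-unique xs! zero = All.[] ∷ []
  vectorsOver-unique xs! (suc n) =
    cartesianProductWith⁺ _∷_ ∷-injective xs! (vectorsOver-unique xs! n)

  length-vectorsOver : ∀ n → length (vectorsOver xs n) ≡ length xs ^ n
  length-vectorsOver zero = refl
  length-vectorsOver (suc n) =
    trans (length-cartesianProductWith _∷_ xs (vectorsOver xs n)) (cong (length xs *_) (length-vectorsOver n))

private
  variable
    n : ℕ
    x y : Z3^ n

one two : Z3
one = fs fz
two = fs (fs fz)

_-₃_ : Z3 → Z3 → Z3
a -₃ b = a +₃ (-₃ b)

sum₃ : ∀ {n} → Z3^ n → Z3
sum₃ [] = fz
sum₃ (a ∷ v) = a +₃ sum₃ v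

-₃-self : ∀ a → a -₃ a ≡ fz
-₃-self = toWitness {a? = all? λ a → a -₃ a ≟ fz} tt

-₃≡0⇒≡ : ∀ a b → a -₃ b ≡ fz → a ≡ b
-₃≡0⇒≡ = toWitness {a? = all? λ a → all? λ b → (a -₃ b ≟ fz) →-dec (a ≟ b)} tt

≢⇒-₃≡±1 : ∀ a b → a ≢ b → b -₃ a ≡ one ⊎ a -₃ b ≡ one
≢⇒-₃≡±1 = toWitness
  {a? = all? λ a → all? λ b → ¬? (a ≟ b) →-dec ((b -₃ a ≟ one) ⊎-dec (a -₃ b ≟ one))} tt

+₃-cancelʳ : ∀ s a b → a +₃ s ≡ b +₃ s → a ≡ b
+₃-cancelʳ = toWitness {a? = all? λ s → all? λ a → all? λ b → (a +₃ s ≟ b +₃ s) →-dec (a ≟ b)} tt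

+₃-cancelˡ : ∀ a s t → a +₃ s ≡ a +₃ t → s ≡ t
+₃-cancelˡ = toWitness {a? = all? λ a → all? λ s → all? λ t → (a +₃ s ≟ a +₃ t) →-dec (s ≟ t)} tt

-₃-+₃-cancel : ∀ c s → (c -₃ s) +₃ s ≡ c
-₃-+₃-cancel = toWitness {a? = all? λ c → all? λ s → (c -₃ s) +₃ s ≟ c} tt

+₃-identityˡ : ∀ a → fz +₃ a ≡ a
+₃-identityˡ = toWitness {a? = all? λ a → fz +₃ a ≟ a} tt

data OneApart : ∀ {n} → Z3^ n → Z3^ n → Set where
  at-head : ∀ {n a b} {v : Z3^ n} → a ≢ b → OneApart (a ∷ v) (b ∷ v)
  in-tail : ∀ {n a} {v w : Z3^ n} → OneApart v w → OneApart (a ∷ v) (a ∷ w)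

oneApart-sym : OneApart x y → OneApart y x
oneApart-sym (at-head a≢b) = at-head (a≢b ∘ sym)
oneApart-sym (in-tail p) = in-tail (oneApart-sym p)

oneApart-irrefl : ¬ OneApart x x
oneApart-irrefl (at-head a≢a) = a≢a refl
oneApart-irrefl (in-tail p) = oneApart-irrefl p

oneApart⇒sum≢ : OneApart x y → sum₃ x ≢ sum₃ y
oneApart⇒sum≢ {x = a ∷ v} (at-head a≢b) = a≢b ∘ +₃-cancelʳ (sum₃ v) _ _
oneApart⇒sum≢ {x = a ∷ _} (in-tail p) = oneApart⇒sum≢ p ∘ +₃-cancelˡ a _ _

≢-tail≡⇒oneApart : x ≢ y → tail x ≡ tail y → OneApart x y
≢-tail≡⇒oneApart {x = a ∷ v} {y = b ∷ .v} x≢y refl = at-head (λ { refl → x≢y refl })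

Adjacent : Z3^ n → Z3^ n → Set
Adjacent {n} = CayAdj (basis n)

⊖≡0⇒≡ : (v w : Z3^ n) → w ⊖ v ≡ tabulate (λ _ → fz) → w ≡ v
⊖≡0⇒≡ [] [] _ = refl
⊖≡0⇒≡ (a ∷ v) (b ∷ w) eq = cong₂ _∷_ (-₃≡0⇒≡ b a (∷-injectiveˡ eq)) (⊖≡0⇒≡ v w (∷-injectiveʳ eq))

⊖-self : (v : Z3^ n) → v ⊖ v ≡ tabulate (λ _ → fz)
⊖-self [] = refl
⊖-self (a ∷ v) = cong₂ _∷_ (-₃-self a) (⊖-self v)

step⇒oneApart : (j : Fin n) (x y : Z3^ n) → y ⊖ x ≡ e j → OneApart x y
step⇒oneApart fz (a ∷ v) (b ∷ w) eq rewrite ⊖≡0⇒≡ v w (∷-injectiveʳ eq) =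
  at-head λ { refl → 0≢1 (trans (sym (-₃-self a)) (∷-injectiveˡ eq)) }
  where
  0≢1 : fz ≢ one
  0≢1 ()
step⇒oneApart (fs j) (a ∷ v) (b ∷ w) eq rewrite -₃≡0⇒≡ b a (∷-injectiveˡ eq) =
  in-tail (step⇒oneApart j v w (∷-injectiveʳ eq))

adjacent⇒oneApart : Adjacent x y → OneApart x y
adjacent⇒oneApart {x = x} {y} (inj₁ y⊖x∈) with ∈-map⁻ e y⊖x∈
... | j , _ , y⊖x≡ej = step⇒oneApart j x y y⊖x≡ej
adjacent⇒oneApart {x = x} {y} (inj₂ x⊖y∈) with ∈-map⁻ e x⊖y∈
... | j , _ , x⊖y≡ej = oneApart-sym (step⇒oneApart j y x x⊖y≡ej)

e∈basis : (j : Fin n) → e j ∈ basis n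
e∈basis j = ∈-map⁺ e (∈-allFin j)

∷-∈-basis : ∀ a {u : Z3^ n} → u ∈ basis n → (a -₃ a) ∷ u ∈ basis (suc n)
∷-∈-basis a u∈ with ∈-map⁻ e u∈
... | j , _ , refl rewrite -₃-self a = e∈basis (fs j)

oneApart⇒adjacent : OneApart x y → Adjacent x y
oneApart⇒adjacent {x = a ∷ v} (at-head a≢b) = ⊎-map e₀∈basis e₀∈basis (≢⇒-₃≡±1 a _ a≢b)
  where
  e₀∈basis : ∀ {c} → c ≡ one → c ∷ (v ⊖ v) ∈ basis _
  e₀∈basis refl rewrite ⊖-self v = e∈basis fz
oneApart⇒adjacent {x = a ∷ _} (in-tail p) = ⊎-map (∷-∈-basis a) (∷-∈-basis a) (oneApart⇒adjacent p)

adjacent⇒sum≢ : Adjacent x y → sum₃ x ≢ sum₃ y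
adjacent⇒sum≢ = oneApart⇒sum≢ ∘ adjacent⇒oneApart

allZ3^ : (n : ℕ) → List (Z3^ n)
allZ3^ = vectorsOver (allFin 3)

level : Z3 → (n : ℕ) → List (Z3^ (suc n))
level c n = map (λ v → (c -₃ sum₃ v) ∷ v) (allZ3^ n)

module _ (c : Z3) (n : ℕ) where

  level-unique : Unique (level c n)
  level-unique = map⁺ ∷-injectiveʳ (vectorsOver-unique (allFin⁺ 3) n)

  length-level : length (level c n) ≡ 3 ^ n
  length-level = trans (length-map _ (allZ3^ n)) (length-vectorsOver n)

  ∈-level⇒sum : x ∈ level c n → sum₃ x ≡ c
  ∈-level⇒sum x∈ with ∈-map⁻ _ x∈
  ... | v , _ , refl = -₃-+₃-cancel c (sum₃ v)

  level-independent : Independent (basis (suc n)) (level c n)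
  level-independent x∈ y∈ adj = adjacent⇒sum≢ adj (trans (∈-level⇒sum x∈) (sym (∈-level⇒sum y∈)))

module _ (C : List (Z3^ n)) {K : List (Z3^ n)} where

  degIn≤maxDegIn : x ∈ K → degIn C K x ≤ maxDegIn C K
  degIn≤maxDegIn x∈ = ∈⇒≤foldr-⊔ (∈-map⁺ (degIn C K) x∈)

  maxDegIn≤ : ∀ {k} → (∀ {x} → x ∈ K → degIn C K x ≤ k) → maxDegIn C K ≤ k
  maxDegIn≤ deg≤ = foldr-⊔-lub (Allₚ.map⁺ (All.tabulate deg≤))

module _ {r : ℕ} {K : List (Z3^ (suc r))} (K! : Unique K) (large : 3 ^ r < length K) where

  large⇒oneApart : ∃₂ λ x y → x ∈ K × y ∈ K × OneApart x y
  large⇒oneApart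
    with pigeonhole _≟V_ tail K! (∈-vectorsOver ∈-allFin ∘ tail)
                    (subst (_< length K) (sym (length-vectorsOver r)) large)
  ... | x , y , x∈ , y∈ , x≢y , tails≡ = x , y , x∈ , y∈ , ≢-tail≡⇒oneApart x≢y tails≡

  large⇒dependent : ¬ Independent (basis (suc r)) K
  large⇒dependent independent with large⇒oneApart
  ... | x , y , x∈ , y∈ , x~y = independent x∈ y∈ (oneApart⇒adjacent x~y)

  large⇒1≤maxDegIn : 1 ≤ maxDegIn (basis (suc r)) K
  large⇒1≤maxDegIn with large⇒oneApart
  ... | x , y , x∈ , y∈ , x~y =
    ≤-trans (filter-some (cayAdj? _ x) (lose y∈ (oneApart⇒adjacent x~y))) (degIn≤maxDegIn _ x∈)

independent⇒length≤ : {r : ℕ} {K : List (Z3^ (suc r))} →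
                      Unique K → Independent (basis (suc r)) K → length K ≤ 3 ^ r
independent⇒length≤ {r} {K} K! independent with length K ≤? 3 ^ r
... | yes K≤ = K≤
... | no K≰ = ⊥-elim (large⇒dependent K! (≰⇒> K≰) independent)

nonzero : List Z3
nonzero = one ∷ two ∷ []

nearlyIndependent : (m : ℕ) → List (Z3^ (suc m))
nearlyIndependent zero = (fz ∷ []) ∷ (one ∷ []) ∷ []
nearlyIndependent (suc m) =
  map (fz ∷_) (nearlyIndependent m) ++ cartesianProductWith _∷_ nonzero (level two m)

data NearlyIndependentView (m : ℕ) : Z3^ (suc (suc m)) → Set where
  zero-head : {v : Z3^ (suc m)} → v ∈ nearlyIndependent m → NearlyIndependentView m (fz ∷ v)
  one-head  : {v : Z3^ (suc m)} → v ∈ level two m → NearlyIndependentView m (one ∷ v)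
  two-head  : {v : Z3^ (suc m)} → v ∈ level two m → NearlyIndependentView m (two ∷ v)

nearlyIndependent-view : ∀ {m} {x} → x ∈ nearlyIndependent (suc m) → NearlyIndependentView m x
nearlyIndependent-view {m} x∈ with ∈-++⁻ (map (fz ∷_) (nearlyIndependent m)) x∈
... | inj₁ x∈₀ with ∈-map⁻ (fz ∷_) x∈₀
...   | v , v∈ , refl = zero-head v∈
nearlyIndependent-view {m} x∈ | inj₂ x∈₁₂ with ∈-cartesianProductWith⁻ _∷_ nonzero (level two m) x∈₁₂
...   | _ , v , here refl , v∈ , refl = one-head v∈
...   | _ , v , there (here refl) , v∈ , refl = two-head v∈

nearlyIndependent-unique : ∀ m → Unique (nearlyIndependent m)
nearlyIndependent-unique zero = ((λ ()) All.∷ All.[]) ∷ All.[] ∷ []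
nearlyIndependent-unique (suc m) =
  ++⁺ (map⁺ ∷-injectiveʳ (nearlyIndependent-unique m))
      (cartesianProductWith⁺ _∷_ ∷-injective (((λ ()) All.∷ All.[]) ∷ All.[] ∷ []) (level-unique two m))
      zero-head∉nonzero-heads
  where
  zero-head∉nonzero-heads : ∀ {x} → ¬ (x ∈ map (fz ∷_) (nearlyIndependent m) ×
                                       x ∈ cartesianProductWith _∷_ nonzero (level two m))
  zero-head∉nonzero-heads (x∈₀ , x∈₁₂)
    with ∈-map⁻ (fz ∷_) x∈₀ | ∈-cartesianProductWith⁻ _∷_ nonzero (level two m) x∈₁₂
  ... | _ , _ , refl | _ , _ , here () , _ , refl
  ... | _ , _ , refl | _ , _ , there (here ()) , _ , refl

length-nearlyIndependent : ∀ m → length (nearlyIndependent m) ≡ suc (3 ^ m)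
length-nearlyIndependent zero = refl
length-nearlyIndependent (suc m) = begin
  length (map (fz ∷_) (nearlyIndependent m) ++ cartesianProductWith _∷_ nonzero (level two m))
    ≡⟨ length-++ (map (fz ∷_) (nearlyIndependent m)) ⟩
  length (map (fz ∷_) (nearlyIndependent m)) + length (cartesianProductWith _∷_ nonzero (level two m))
    ≡⟨ cong₂ _+_ (trans (length-map (fz ∷_) (nearlyIndependent m)) (length-nearlyIndependent m))
                 (trans (length-cartesianProductWith _∷_ nonzero (level two m)) (cong (2 *_) (length-level two m))) ⟩
  suc (3 ^ m) + 2 * 3 ^ m
    ∎
  where open ≡-Reasoning

∈-nearlyIndependent⇒sum≢2 : ∀ {m x} → x ∈ nearlyIndependent m → sum₃ x ≢ two
∈-nearlyIndependent⇒sum≢2 {zero} (here refl) ()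
∈-nearlyIndependent⇒sum≢2 {zero} (there (here refl)) ()
∈-nearlyIndependent⇒sum≢2 {suc m} x∈ with nearlyIndependent-view x∈
... | zero-head {v} v∈ rewrite +₃-identityˡ (sum₃ v) = ∈-nearlyIndependent⇒sum≢2 v∈
... | one-head v∈ rewrite ∈-level⇒sum two m v∈ = λ ()
... | two-head v∈ rewrite ∈-level⇒sum two m v∈ = λ ()

AtMostOneNeighbourIn : List (Z3^ n) → Z3^ n → Set
AtMostOneNeighbourIn K x = ∃ λ u → ∀ {w} → w ∈ K → OneApart x w → w ≡ u

nearlyIndependent-sparse : ∀ {m x} → x ∈ nearlyIndependent m →
                           AtMostOneNeighbourIn (nearlyIndependent m) x
nearlyIndependent-sparse {zero} (here refl) = one ∷ [] , λ
  { (here refl) x~x → ⊥-elim (oneApart-irrefl x~x)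
  ; (there (here refl)) _ → refl }
nearlyIndependent-sparse {zero} (there (here refl)) = fz ∷ [] , λ
  { (here refl) _ → refl
  ; (there (here refl)) x~x → ⊥-elim (oneApart-irrefl x~x) }
nearlyIndependent-sparse {suc m} x∈ with nearlyIndependent-view x∈
... | zero-head v∈ with nearlyIndependent-sparse v∈
...   | u , only-u = fz ∷ u , λ w∈ → neighbour (nearlyIndependent-view w∈)
  where
  neighbour : ∀ {w} → NearlyIndependentView m w → OneApart _ w → w ≡ fz ∷ u
  neighbour (zero-head w∈) (at-head 0≢0) = ⊥-elim (0≢0 refl)
  neighbour (zero-head w∈) (in-tail v~w) = cong (fz ∷_) (only-u w∈ v~w)
  neighbour (one-head v∈₂) (at-head _) = ⊥-elim (∈-nearlyIndependent⇒sum≢2 v∈ (∈-level⇒sum two m v∈₂))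
  neighbour (two-head v∈₂) (at-head _) = ⊥-elim (∈-nearlyIndependent⇒sum≢2 v∈ (∈-level⇒sum two m v∈₂))
nearlyIndependent-sparse {suc m} x∈ | one-head v∈ = two ∷ _ , λ w∈ → neighbour (nearlyIndependent-view w∈)
  where
  neighbour : ∀ {w} → NearlyIndependentView m w → OneApart _ w → w ≡ two ∷ _
  neighbour (zero-head v∈₀) (at-head _) = ⊥-elim (∈-nearlyIndependent⇒sum≢2 v∈₀ (∈-level⇒sum two m v∈))
  neighbour (one-head _) (at-head 1≢1) = ⊥-elim (1≢1 refl)
  neighbour (one-head w∈) (in-tail v~w) = ⊥-elim (level-independent two m v∈ w∈ (oneApart⇒adjacent v~w))
  neighbour (two-head _) (at-head _) = refl
nearlyIndependent-sparse {suc m} x∈ | two-head v∈ = one ∷ _ , λ w∈ → neighbour (nearlyIndependent-view w∈)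
  where
  neighbour : ∀ {w} → NearlyIndependentView m w → OneApart _ w → w ≡ one ∷ _
  neighbour (zero-head v∈₀) (at-head _) = ⊥-elim (∈-nearlyIndependent⇒sum≢2 v∈₀ (∈-level⇒sum two m v∈))
  neighbour (one-head _) (at-head _) = refl
  neighbour (two-head _) (at-head 2≢2) = ⊥-elim (2≢2 refl)
  neighbour (two-head w∈) (in-tail v~w) = ⊥-elim (level-independent two m v∈ w∈ (oneApart⇒adjacent v~w))

degIn≤1 : {K : List (Z3^ n)} → Unique K → AtMostOneNeighbourIn K x → degIn (basis n) K x ≤ 1
degIn≤1 {x = x} K! (u , only-u) =
  length-filter≤1 (cayAdj? _ x) K! (λ w∈ x~w → only-u w∈ (adjacent⇒oneApart x~w))

maxDegIn-nearlyIndependent≤1 : ∀ m → maxDegIn (basis (suc m)) (nearlyIndependent m) ≤ 1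
maxDegIn-nearlyIndependent≤1 m =
  maxDegIn≤ _ (degIn≤1 (nearlyIndependent-unique m) ∘ nearlyIndependent-sparse)

theorem8p1 : (r : ℕ) → Σ ℕ λ a → IsAlpha (basis (suc r)) a × IsSigma (basis (suc r)) a 1
theorem8p1 r = 3 ^ r , α , σ
  where
  N : List (Z3^ (suc r))
  N = nearlyIndependent r
  N! : Unique N
  N! = nearlyIndependent-unique r
  N-large : 3 ^ r < length N
  N-large = ≤-reflexive (sym (length-nearlyIndependent r))
  α : IsAlpha (basis (suc r)) (3 ^ r)
  α = (level fz r , level-unique fz r , level-independent fz r , length-level fz r)
    , λ K K! → independent⇒length≤ K!
  σ : IsSigma (basis (suc r)) (3 ^ r) 1
  σ = (N , N! , N-large , ≤-antisym (maxDegIn-nearlyIndependent≤1 r) (large⇒1≤maxDegIn N! N-large))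
    , λ K K! → large⇒1≤maxDegIn K!
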